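{- For every $\exists^I$-formula $K(a)$, the set $\widehat K$ is upward closed with respect to the configuration pre-order $\le$. For all $\exists^I$-formulae $K_1,K_2$, we have $\widehat{K_1}\subseteq\widehat{K_2}$ if and only if $A_I^E\models K_1\to K_2$.
   Context: A theory $T=(\Sigma,\mathcal C)$ is a signature with a class of $\Sigma$-structures (its models); $T\models\varphi$ means $\varphi$ holds in all models under all assignments. Fix $T_I=(\Sigma_I,\mathcal C_I)$ with sort INDEX and $T_E=(\Sigma_E,\mathcal C_E)$ with sort ELEM. $A_I^E$ is the theory with sorts INDEX, ELEM, ARRAY, signature $\Sigma_I\cup\Sigma_E\cup\{\_[\_]\}$ ($\_[\_]$: ARRAY$\times$INDEX$\to$ELEM), whose models are the three-sorted structures with INDEX-part $\mathcal M_I$ a model of $T_I$, ELEM-part $\mathcal M_E$ a model of $T_E$, ARRAY the set of all total functions from INDEX to ELEM, and $a[i]$ function application. An $\exists^I$-formula is $\exists\underline i\,\phi(\underline i,a[\underline i])$ with $a$ an ARRAY variable, $\underline i$ INDEX variables and $\phi(\underline i,\underline e)$ a quantifier-free $(\Sigma_I\cup\Sigma_E)$-formula in which $a[\underline i]$ is substituted for the ELEM variables $\underline e$. Standing assumptions: $T_I$ is locally finite ($\Sigma_I$ finite and, for each finite tuple of variables, finitely many effectively computable terms represent every term up to $T_I$-equality) and closed under substructures (substructures of models of $T_I$ are models of $T_I$); quantifier-free satisfiability modulo $T_I$ and modulo $T_E$ is decidable. A configuration is a pair $(s,\mathcal M)$ with $\mathcal M$ a model of $A_I^E$ whose INDEX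 domain is finite and $s$ an element of its ARRAY domain. Let $s_I=\mathcal M_I$ and let $s_E$ be the smallest $\Sigma_E$-substructure of $\mathcal M_E$ containing the image of $s$. For configurations $s',s$, $s'\le s$ iff there are a $\Sigma_I$-embedding $\mu:s'_I\to s_I$ and a $\Sigma_E$-embedding $\nu:s'_E\to s_E$ with $\nu\circ s'=s\circ\mu$. A set of configurations $X$ is upward closed if $p\in X$ and $p\le q$ imply $q\in X$. For an $\exists^I$-formula $K(a)$, $\widehat K=\{(s,\mathcal M)\text{ configuration}\mid \mathcal M\models K(s)\}$. -}

module Defs where

open import Level using (Level; 0ℓ) renaming (suc to lsuc)
open import Data.Nat using (ℕ)
open import Data.Fin using (Fin)
open import Data.Vec using (Vec; []; _∷_)
import Data.Vec as Vec
open import Data.Vec.Relation.Binary.Pointwise.Inductive using (Pointwise)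
open import Data.Product using (Σ; ∃; _×_; _,_; proj₁; proj₂)
open import Data.Unit using (⊤)
open import Data.Empty using (⊥)
open import Relation.Nullary using (¬_; Dec)
open import Relation.Binary using (Setoid; IsEquivalence)
open import Function.Bundles using (Func; _↔_; _⇔_)

record Signature : Set₁ where
  field
    FunSym : Set
    funArity : FunSym → ℕ
    RelSym : Set
    relArity : RelSym → ℕ
open Signature public

data Term (Σ' : Signature) (V : Set) : Set where
  var : V → Term Σ' V
  app : (f : FunSym Σ') → Vec (Term Σ' V) (funArity Σ' f) → Term Σ' V

record Structure (Σ' : Signature) : Set₁ where
  field
    setoid : Setoid 0ℓ 0ℓ
  open Setoid setoid public using (Carrier; _≈_)
  field
    fun : (f : FunSym Σ') → Vec Carrier (funArity Σ' f) → Carrier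
    fun-cong : ∀ f {xs ys} → Pointwise _≈_ xs ys → fun f xs ≈ fun f ys
    rel : (r : RelSym Σ') → Vec Carrier (relArity Σ' r) → Set
    rel-cong : ∀ r {xs ys} → Pointwise _≈_ xs ys → rel r xs → rel r ys
open Structure public

module _ {Σ' : Signature} (M : Structure Σ') {V : Set} (ρ : V → Carrier M) where
  mutual
    eval : Term Σ' V → Carrier M
    eval (var x) = ρ x
    eval (app f ts) = fun M f (evalVec ts)

    evalVec : ∀ {n} → Vec (Term Σ' V) n → Vec (Carrier M) n
    evalVec [] = []
    evalVec (t ∷ ts) = eval t ∷ evalVec ts

record Embedding {Σ' : Signature} (N M : Structure Σ') : Set where
  field
    map : Func (setoid N) (setoid M)
  h : Carrier N → Carrier M
  h = Func.to map
  field
    injective : ∀ {x y} → _≈_ M (h x) (h y) → _≈_ N x y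
    pres-fun : ∀ f xs → _≈_ M (h (fun N f xs)) (fun M f (Vec.map h xs))
    pres-rel : ∀ r xs → rel N r xs ⇔ rel M r (Vec.map h xs)

data QF (Σ' : Signature) (V : Set) : Set where
  tt ff : QF Σ' V
  _≐_ : Term Σ' V → Term Σ' V → QF Σ' V
  relA : (r : RelSym Σ') → Vec (Term Σ' V) (relArity Σ' r) → QF Σ' V
  ~_ : QF Σ' V → QF Σ' V
  _∧_ _∨_ : QF Σ' V → QF Σ' V → QF Σ' V

⟦_⟧QF : ∀ {Σ' V} → QF Σ' V → (M : Structure Σ') → (V → Carrier M) → Set
⟦ tt ⟧QF M ρ = ⊤
⟦ ff ⟧QF M ρ = ⊥
⟦ t ≐ u ⟧QF M ρ = _≈_ M (eval M ρ t) (eval M ρ u)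
⟦ relA r ts ⟧QF M ρ = rel M r (evalVec M ρ ts)
⟦ ~ φ ⟧QF M ρ = ¬ ⟦ φ ⟧QF M ρ
⟦ φ ∧ ψ ⟧QF M ρ = ⟦ φ ⟧QF M ρ × ⟦ ψ ⟧QF M ρ
⟦ φ ∨ ψ ⟧QF M ρ = Data.Sum._⊎_ (⟦ φ ⟧QF M ρ) (⟦ ψ ⟧QF M ρ)
  where import Data.Sum

record Theory : Set₂ where
  field
    sig : Signature
    Models : Structure sig → Set₁
open Theory public

_⊨_≐_ : (T : Theory) {V : Set} → Term (sig T) V → Term (sig T) V → Set₁
T ⊨ t ≐ u = ∀ (M : Structure (sig T)) → Models T M → ∀ ρ → _≈_ M (eval M ρ t) (eval M ρ u)

FiniteSet : Set → Set
FiniteSet A = Σ ℕ λ k → A ↔ Fin k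

LocallyFinite : Theory → Set₁
LocallyFinite T =
  FiniteSet (FunSym (sig T)) × FiniteSet (RelSym (sig T)) ×
  (∀ (n : ℕ) → Σ ℕ λ m → Σ (Fin m → Term (sig T) (Fin n)) λ reps →
     Σ (Term (sig T) (Fin n) → Fin m) λ rep →
       ∀ t → T ⊨ t ≐ reps (rep t))

-- closure under substructures (a substructure of M = a structure embedding into M)
ClosedUnderSubstructures : Theory → Set₁
ClosedUnderSubstructures T =
  ∀ (N M : Structure (sig T)) → Embedding N M → Models T M → Models T N

QFSatDecidable : Theory → Set₁
QFSatDecidable T = ∀ {n : ℕ} (φ : QF (sig T) (Fin n)) →
  Dec (Σ (Structure (sig T)) λ M → Models T M × Σ (Fin n → Carrier M) λ ρ → ⟦ φ ⟧QF M ρ)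

data QF₂ (ΣI ΣE : Signature) (VI VE : Set) : Set where
  tt ff : QF₂ ΣI ΣE VI VE
  eqI : Term ΣI VI → Term ΣI VI → QF₂ ΣI ΣE VI VE
  relI : (r : RelSym ΣI) → Vec (Term ΣI VI) (relArity ΣI r) → QF₂ ΣI ΣE VI VE
  eqE : Term ΣE VE → Term ΣE VE → QF₂ ΣI ΣE VI VE
  relE : (r : RelSym ΣE) → Vec (Term ΣE VE) (relArity ΣE r) → QF₂ ΣI ΣE VI VE
  ~_ : QF₂ ΣI ΣE VI VE → QF₂ ΣI ΣE VI VE
  _∧_ _∨_ : QF₂ ΣI ΣE VI VE → QF₂ ΣI ΣE VI VE → QF₂ ΣI ΣE VI VE

⟦_⟧₂ : ∀ {ΣI ΣE VI VE} → QF₂ ΣI ΣE VI VE →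
  (MI : Structure ΣI) (ME : Structure ΣE) → (VI → Carrier MI) → (VE → Carrier ME) → Set
⟦ tt ⟧₂ MI ME ρI ρE = ⊤
⟦ ff ⟧₂ MI ME ρI ρE = ⊥
⟦ eqI t u ⟧₂ MI ME ρI ρE = _≈_ MI (eval MI ρI t) (eval MI ρI u)
⟦ relI r ts ⟧₂ MI ME ρI ρE = rel MI r (evalVec MI ρI ts)
⟦ eqE t u ⟧₂ MI ME ρI ρE = _≈_ ME (eval ME ρE t) (eval ME ρE u)
⟦ relE r ts ⟧₂ MI ME ρI ρE = rel ME r (evalVec ME ρE ts)
⟦ ~ φ ⟧₂ MI ME ρI ρE = ¬ ⟦ φ ⟧₂ MI ME ρI ρE
⟦ φ ∧ ψ ⟧₂ MI ME ρI ρE = ⟦ φ ⟧₂ MI ME ρI ρE × ⟦ ψ ⟧₂ MI ME ρI ρE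
⟦ φ ∨ ψ ⟧₂ MI ME ρI ρE = Data.Sum._⊎_ (⟦ φ ⟧₂ MI ME ρI ρE) (⟦ ψ ⟧₂ MI ME ρI ρE)
  where import Data.Sum

module ArrayTheory (TI TE : Theory) where

  -- a model of A_I^E: INDEX part a model of T_I, ELEM part a model of T_E;
  -- ARRAY is the set of all (setoid) functions INDEX → ELEM, a[i] = application
  record ModelA : Set₂ where
    field
      MI : Structure (sig TI)
      MI-model : Models TI MI
      ME : Structure (sig TE)
      ME-model : Models TE ME
  open ModelA public

  Array : ModelA → Set
  Array M = Func (setoid (MI M)) (setoid (ME M))

  -- ∃^I-formula  ∃ i₁..iₙ φ(i, a[i])
  record ExistsI : Set where
    field
      n : ℕ
      φ : QF₂ (sig TI) (sig TE) (Fin n) (Fin n)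
  open ExistsI public

  _,_⊨∃_ : (M : ModelA) → Array M → ExistsI → Set
  M , a ⊨∃ K = Σ (Fin (n K) → Carrier (MI M)) λ i →
    ⟦ φ K ⟧₂ (MI M) (ME M) i (λ j → Func.to a (i j))

  ⊨A_⇒_ : ExistsI → ExistsI → Set₂
  ⊨A K₁ ⇒ K₂ = ∀ (M : ModelA) (a : Array M) → M , a ⊨∃ K₁ → M , a ⊨∃ K₂

  FiniteSetoid : Setoid 0ℓ 0ℓ → Set
  FiniteSetoid S = Σ ℕ λ k → Σ (Fin k → Setoid.Carrier S) λ e →
    ∀ x → ∃ λ j → Setoid._≈_ S (e j) x

  record Configuration : Set₂ where
    field
      M : ModelA
      finiteIndex : FiniteSetoid (setoid (MI M))
      s : Array M
  open Configuration public

  -- smallest substructure of M generated by the image of g : V → M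
  -- (elements: Σ-terms over V, identified when they evaluate equally in M)
  Generated : ∀ {Σ'} (M : Structure Σ') {V : Set} (g : V → Carrier M) → Structure Σ'
  Generated {Σ'} M {V} g = record
    { setoid = record
        { Carrier = Term Σ' V
        ; _≈_ = λ t u → _≈_ M (eval M g t) (eval M g u)
        ; isEquivalence = record
            { refl = Setoid.refl (setoid M)
            ; sym = Setoid.sym (setoid M)
            ; trans = Setoid.trans (setoid M) } }
    ; fun = app
    ; fun-cong = λ f ps → fun-cong M f (lemma ps)
    ; rel = λ r ts → rel M r (evalVec M g ts)
    ; rel-cong = λ r ps → rel-cong M r (lemma ps)
    }
    where
      lemma : ∀ {k} {ts us : Vec (Term Σ' V) k} →
        Pointwise (λ t u → _≈_ M (eval M g t) (eval M g u)) ts us →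
        Pointwise (_≈_ M) (evalVec M g ts) (evalVec M g us)
      lemma Pointwise.[] = Pointwise.[]
      lemma (p Pointwise.∷ ps) = p Pointwise.∷ lemma ps
      import Data.Vec.Relation.Binary.Pointwise.Inductive as Pointwise

  confI : Configuration → Structure (sig TI)
  confI c = MI (M c)

  confE : (c : Configuration) → Structure (sig TE)
  confE c = Generated (ME (M c)) (Func.to (s c))

  _≤c_ : Configuration → Configuration → Set
  s' ≤c s = Σ (Embedding (confI s') (confI s)) λ μ →
            Σ (Embedding (confE s') (confE s)) λ ν →
              ∀ (x : Carrier (confI s')) →
                _≈_ (confE s) (Embedding.h ν (var x)) (var (Embedding.h μ x))

  UpwardClosed : (Configuration → Set) → Set₂
  UpwardClosed X = ∀ p q → p ≤c q → X p → X q

  hat : ExistsI → Configuration → Set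
  hat K c = M c , s c ⊨∃ K

  _⊆_ : (Configuration → Set) → (Configuration → Set) → Set₂
  X ⊆ Y = ∀ c → X c → Y c

-- The whole argument rests on one invariance fact: a quantifier-free
-- (Σ_I ∪ Σ_E)-formula has the same truth value in a pair of structures and in
-- any pair of structures into which they embed, provided the assignments
-- correspond along the embeddings (`qf₂-invariant`).
--
-- * Upward closure: a witness for K in a configuration p is a witness in the
--   pair (p_I, p_E), since p_E embeds into the ELEM model; along p ≤ q it is
--   carried to (q_I, q_E) and from there back into the models of q.
-- * Inclusion ⇒ entailment: given M, a and a witness ī for K₁, restrict the
--   INDEX part to the substructure generated by ī.  It is finite by local
--   finiteness and a model of T_I by closure under substructures, so it
--   yields a configuration in K̂₁ ⊆ K̂₂; the K₂-witness found there is
--   transported back along the inclusion of the substructure.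
-- * Entailment ⇒ inclusion is immediate, configurations being models.
module Submission where

open import Defs
open import Data.Product using (_×_; _,_)
open import Data.Fin using (Fin)
open import Data.Vec using (Vec; []; _∷_)
import Data.Vec as Vec
open import Data.Vec.Properties using (map-id)
open import Data.Vec.Relation.Binary.Pointwise.Inductive as PW using (Pointwise)
open import Data.Product.Function.NonDependent.Propositional using (_×-⇔_)
open import Data.Sum.Function.Propositional using (_⊎-⇔_)
open import Function.Base using (id; _∘_)
open import Function.Bundles using (Func; _⇔_; mk⇔; Equivalence)
import Function.Construct.Composition as Composition
import Function.Construct.Identity as Identity
open import Function.Related.TypeIsomorphisms using (¬-cong-⇔)
open import Relation.Binary using (Setoid)
open import Relation.Binary.PropositionalEquality using (_≡_; refl; sym; cong; subst)

private
  module S {Σ' : Signature} (M : Structure Σ') = Setoid (setoid M)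

subst-⇔ : ∀ {A : Set} (P : A → Set) {x y : A} → x ≡ y → P x ⇔ P y
subst-⇔ P x≡y = mk⇔ (subst P x≡y) (subst P (sym x≡y))

evalVec-map : ∀ {Σ' V} (M : Structure Σ') (ρ : V → Carrier M) {k} (ts : Vec (Term Σ' V) k) →
  evalVec M ρ ts ≡ Vec.map (eval M ρ) ts
evalVec-map M ρ []       = refl
evalVec-map M ρ (t ∷ ts) = cong (eval M ρ t ∷_) (evalVec-map M ρ ts)

module EmbeddingInvariance {Σ' : Signature} {A A' : Structure Σ'} (μ : Embedding A A')
       {V : Set} (ρ : V → Carrier A) (ρ' : V → Carrier A')
       (ρ'≈μρ : ∀ x → _≈_ A' (ρ' x) (Embedding.h μ (ρ x))) where

  open Embedding μ using (h)

  mutual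
    eval-embed : ∀ t → _≈_ A' (eval A' ρ' t) (h (eval A ρ t))
    eval-embed (var x)    = ρ'≈μρ x
    eval-embed (app f ts) =
      S.trans A' (fun-cong A' f (evalVec-embed ts)) (S.sym A' (Embedding.pres-fun μ f (evalVec A ρ ts)))

    evalVec-embed : ∀ {k} (ts : Vec (Term Σ' V) k) →
      Pointwise (_≈_ A') (evalVec A' ρ' ts) (Vec.map h (evalVec A ρ ts))
    evalVec-embed []       = PW.[]
    evalVec-embed (t ∷ ts) = eval-embed t PW.∷ evalVec-embed ts

  eq-invariant : ∀ t u → _≈_ A (eval A ρ t) (eval A ρ u) ⇔ _≈_ A' (eval A' ρ' t) (eval A' ρ' u)
  eq-invariant t u = mk⇔
    (λ t≈u → S.trans A' (eval-embed t) (S.trans A' (Func.cong (Embedding.map μ) t≈u) (S.sym A' (eval-embed u))))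
    (λ t≈u → Embedding.injective μ (S.trans A' (S.sym A' (eval-embed t)) (S.trans A' t≈u (eval-embed u))))

  rel-invariant : ∀ r ts → rel A r (evalVec A ρ ts) ⇔ rel A' r (evalVec A' ρ' ts)
  rel-invariant r ts = mk⇔
    (λ holds → rel-cong A' r (PW.sym (S.sym A') (evalVec-embed ts))
                 (Equivalence.to (Embedding.pres-rel μ r (evalVec A ρ ts)) holds))
    (λ holds → Equivalence.from (Embedding.pres-rel μ r (evalVec A ρ ts))
                 (rel-cong A' r (evalVec-embed ts) holds))

qf₂-invariant : ∀ {ΣI ΣE} {A A' : Structure ΣI} {B B' : Structure ΣE}
  (μ : Embedding A A') (ν : Embedding B B') {VI VE : Set}
  (ρI : VI → Carrier A) (ρI' : VI → Carrier A') (ρE : VE → Carrier B) (ρE' : VE → Carrier B') →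
  (∀ x → _≈_ A' (ρI' x) (Embedding.h μ (ρI x))) →
  (∀ x → _≈_ B' (ρE' x) (Embedding.h ν (ρE x))) →
  ∀ φ → ⟦ φ ⟧₂ A B ρI ρE ⇔ ⟦ φ ⟧₂ A' B' ρI' ρE'
qf₂-invariant {A = A} {A'} {B} {B'} μ ν ρI ρI' ρE ρE' hI hE = invariant
  where
    module I = EmbeddingInvariance μ ρI ρI' hI
    module E = EmbeddingInvariance ν ρE ρE' hE

    invariant : ∀ φ → ⟦ φ ⟧₂ A B ρI ρE ⇔ ⟦ φ ⟧₂ A' B' ρI' ρE'
    invariant tt          = mk⇔ id id
    invariant ff          = mk⇔ id id
    invariant (eqI t u)   = I.eq-invariant t u
    invariant (relI r ts) = I.rel-invariant r ts
    invariant (eqE t u)   = E.eq-invariant t u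
    invariant (relE r ts) = E.rel-invariant r ts
    invariant (~ φ)       = ¬-cong-⇔ (invariant φ)
    invariant (φ ∧ ψ)     = invariant φ ×-⇔ invariant ψ
    invariant (φ ∨ ψ)     = invariant φ ⊎-⇔ invariant ψ

identityEmbedding : ∀ {Σ'} (M : Structure Σ') → Embedding M M
identityEmbedding M = record
  { map       = Identity.function (setoid M)
  ; injective = id
  ; pres-fun  = λ f xs → S.reflexive M (cong (fun M f) (sym (map-id xs)))
  ; pres-rel  = λ r xs → subst-⇔ (rel M r) (sym (map-id xs))
  }

module _ (TI TE : Theory) where
  open ArrayTheory TI TE

  generatedEmbedding : ∀ {Σ'} (M : Structure Σ') {V : Set} (g : V → Carrier M) →
    Embedding (Generated M g) M
  generatedEmbedding M g = record
    { map       = record { to = eval M g ; cong = id }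
    ; injective = id
    ; pres-fun  = λ f ts → S.reflexive M (cong (fun M f) (evalVec-map M g ts))
    ; pres-rel  = λ r ts → subst-⇔ (rel M r) (evalVec-map M g ts)
    }

  configuration-invariant : ∀ (c : Configuration) {VI VE : Set}
    (ρI : VI → Carrier (confI c)) (σ : VE → Carrier (confI c)) φ →
    ⟦ φ ⟧₂ (confI c) (confE c) ρI (var ∘ σ) ⇔ ⟦ φ ⟧₂ (MI (M c)) (ME (M c)) ρI (Func.to (s c) ∘ σ)
  configuration-invariant c ρI σ =
    qf₂-invariant (identityEmbedding (confI c)) (generatedEmbedding (ME (M c)) (Func.to (s c)))
      ρI ρI (var ∘ σ) (Func.to (s c) ∘ σ) (λ _ → S.refl (confI c)) (λ _ → S.refl (ME (M c)))

  hat-upwardClosed : (K : ExistsI) → UpwardClosed (hat K)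
  hat-upwardClosed K p q (μ , ν , ν∘var≈var∘μ) (i , holds-p) = μ.h ∘ i , holds-q
    where
      module μ = Embedding μ
      module ν = Embedding ν

      in-p : ⟦ φ K ⟧₂ (confI p) (confE p) i (var ∘ i)
      in-p = Equivalence.from (configuration-invariant p i i (φ K)) holds-p

      in-q : ⟦ φ K ⟧₂ (confI q) (confE q) (μ.h ∘ i) (var ∘ μ.h ∘ i)
      in-q = Equivalence.to
        (qf₂-invariant μ ν i (μ.h ∘ i) (var ∘ i) (var ∘ μ.h ∘ i) (λ _ → S.refl (confI q))
          (λ j → S.sym (confE q) {ν.h (var (i j))} {var (μ.h (i j))} (ν∘var≈var∘μ (i j))) (φ K))
        in-p

      holds-q : ⟦ φ K ⟧₂ (MI (M q)) (ME (M q)) (μ.h ∘ i) (Func.to (s q) ∘ μ.h ∘ i)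
      holds-q = Equivalence.to (configuration-invariant q (μ.h ∘ i) (μ.h ∘ i) (φ K)) in-q

  -- In a locally finite theory, finitely many elements generate a finite
  -- substructure: every generated element is T-equal to one of finitely many
  -- representative terms.
  generated-finite : LocallyFinite TI → (N : Structure (sig TI)) → Models TI N →
    ∀ {n} (g : Fin n → Carrier N) → FiniteSetoid (setoid (Generated N g))
  generated-finite (_ , _ , representatives) N N-model {n} g
    with representatives n
  ... | m , reps , rep , t≈reps = m , reps , λ t → rep t , S.sym N (t≈reps t N N-model g)

  restrictIndex : (M : ModelA) (N : Structure (sig TI)) → Models TI N → ModelA
  restrictIndex M N N-model = record
    { MI = N ; MI-model = N-model ; ME = ME M ; ME-model = ME-model M }

  restrictArray : (M : ModelA) {N : Structure (sig TI)} (N-model : Models TI N) →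
    Embedding N (MI M) → Array M → Array (restrictIndex M N N-model)
  restrictArray M N-model e a = Composition.function (Embedding.map e) a

  restrict-invariant : (M : ModelA) {N : Structure (sig TI)} (N-model : Models TI N)
    (e : Embedding N (MI M)) (a : Array M) {V : Set} (ρ : V → Carrier N) →
    ∀ φ →
    ⟦ φ ⟧₂ N (ME M) ρ (Func.to (restrictArray M N-model e a) ∘ ρ) ⇔
    ⟦ φ ⟧₂ (MI M) (ME M) (Embedding.h e ∘ ρ) (Func.to a ∘ Embedding.h e ∘ ρ)
  restrict-invariant M N-model e a ρ =
    qf₂-invariant e (identityEmbedding (ME M)) ρ (Embedding.h e ∘ ρ) (Func.to a ∘ Embedding.h e ∘ ρ)
      (Func.to a ∘ Embedding.h e ∘ ρ) (λ _ → S.refl (MI M)) (λ _ → S.refl (ME M))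

  -- Part 2: if K̂₁ ⊆ K̂₂ then A_I^E ⊨ K₁ → K₂.  The INDEX substructure generated
  -- by a K₁-witness carries a configuration satisfying K₁.
  hat-inclusion⇒entailment : LocallyFinite TI → ClosedUnderSubstructures TI →
    ∀ K₁ K₂ → hat K₁ ⊆ hat K₂ → ⊨A K₁ ⇒ K₂
  hat-inclusion⇒entailment locallyFinite closed K₁ K₂ K̂₁⊆K̂₂ M a (i , holds) =
    transport-back (K̂₁⊆K̂₂ c holds-in-c)
    where
      N : Structure (sig TI)
      N = Generated (MI M) i

      e : Embedding N (MI M)
      e = generatedEmbedding (MI M) i

      N-model : Models TI N
      N-model = closed N (MI M) e (MI-model M)

      c : Configuration
      c = record { M = restrictIndex M N N-model
                 ; finiteIndex = generated-finite locallyFinite (MI M) (MI-model M) i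
                 ; s = restrictArray M N-model e a }

      -- the generators themselves witness K₁ in the restricted configuration
      holds-in-c : hat K₁ c
      holds-in-c = var , Equivalence.from (restrict-invariant M N-model e a var (φ K₁)) holds

      transport-back : hat K₂ c → M , a ⊨∃ K₂
      transport-back (i₂ , holds₂) =
        Embedding.h e ∘ i₂ , Equivalence.to (restrict-invariant M N-model e a i₂ (φ K₂)) holds₂

proposition4p2 : (TI TE : Theory) →
    LocallyFinite TI → ClosedUnderSubstructures TI →
    QFSatDecidable TI → QFSatDecidable TE →
    let open ArrayTheory TI TE in
    (∀ (K : ExistsI) → UpwardClosed (hat K)) ×
    (∀ (K₁ K₂ : ExistsI) →
       (hat K₁ ⊆ hat K₂ → ⊨A K₁ ⇒ K₂) × (⊨A K₁ ⇒ K₂ → hat K₁ ⊆ hat K₂))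
proposition4p2 TI TE locallyFinite closed _ _ =
  hat-upwardClosed TI TE ,
  λ K₁ K₂ → hat-inclusion⇒entailment TI TE locallyFinite closed K₁ K₂ ,
            (λ K₁⇒K₂ c → K₁⇒K₂ (M c) (s c))
  where open ArrayTheory TI TE
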